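{- Let $G$ be an ordered abelian group, $p$ a prime, $s\geq1$, and $\alpha\subsetneq D\leq G$ convex subgroups. Then $$|\{\beta+pG:\beta\in\mathcal{S}_p,\ D\supsetneq\beta\supsetneq\alpha\}|=|\{\beta+p^sG:\beta\in\mathcal{S}_p,\ D\supsetneq\beta\supsetneq\alpha\}|.$$
   Context: For $g\in G$, $H_{p,g}$ is the largest convex subgroup of $G$ with $g\notin H_{p,g}+pG$ ($\{0\}$ if $g\in pG$), and $\mathcal{S}_p=\{H_{p,g}:g\in G\}$. -}

module Defs where

open import Level using (Level; 0ℓ) renaming (suc to lsuc)
open import Data.Nat using (ℕ; zero; suc; _^_)
open import Data.Product using (Σ; _×_; _,_; ∃; ∃-syntax)
open import Data.Sum using (_⊎_)
open import Relation.Nullary using (¬_)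
open import Relation.Binary.PropositionalEquality using (_≡_)
open import Relation.Binary.Bundles using (Setoid)
open import Function.Bundles using (Bijection)

record OrderedAbelianGroup : Set₁ where
  infixl 6 _+_
  infix 4 _≤_
  field
    Carrier : Set
    _+_     : Carrier → Carrier → Carrier
    0#      : Carrier
    -_      : Carrier → Carrier
    +-assoc : ∀ x y z → (x + y) + z ≡ x + (y + z)
    +-comm  : ∀ x y → x + y ≡ y + x
    +-idʳ   : ∀ x → x + 0# ≡ x
    +-invʳ  : ∀ x → x + (- x) ≡ 0#
    _≤_     : Carrier → Carrier → Set
    ≤-refl  : ∀ x → x ≤ x
    ≤-trans : ∀ {x y z} → x ≤ y → y ≤ z → x ≤ z
    ≤-antisym : ∀ {x y} → x ≤ y → y ≤ x → x ≡ y
    ≤-total : ∀ x y → x ≤ y ⊎ y ≤ x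
    ≤-+-compat : ∀ {x y} z → x ≤ y → x + z ≤ y + z

module _ (G : OrderedAbelianGroup) where
  open OrderedAbelianGroup G

  Subset : Set₁
  Subset = Carrier → Set

  _⊆_ : Subset → Subset → Set
  A ⊆ B = ∀ x → A x → B x

  _⊊_ : Subset → Subset → Set
  A ⊊ B = A ⊆ B × ¬ (B ⊆ A)

  _≐_ : Subset → Subset → Set
  A ≐ B = A ⊆ B × B ⊆ A

  _·_ : ℕ → Carrier → Carrier
  zero  · x = 0#
  suc n · x = x + (n · x)

  mulG : ℕ → Subset
  mulG n x = ∃[ y ] x ≡ n · y

  _+mul_ : Subset → ℕ → Subset
  (H +mul n) x = ∃[ h ] ∃[ y ] (H h × x ≡ h + (n · y))

  zeroSubgroup : Subset
  zeroSubgroup x = x ≡ 0#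

  IsSubgroup : Subset → Set
  IsSubgroup H = H 0# × (∀ x y → H x → H y → H (x + y)) × (∀ x → H x → H (- x))

  IsConvex : Subset → Set
  IsConvex H = ∀ a b x → H a → H b → a ≤ x → x ≤ b → H x

  IsConvexSubgroup : Subset → Set
  IsConvexSubgroup H = IsSubgroup H × IsConvex H

  IsHpg : ℕ → Carrier → Subset → Set₁
  IsHpg p g H =
    (mulG p g → H ≐ zeroSubgroup) ×
    (¬ mulG p g →
        IsConvexSubgroup H × ¬ (H +mul p) g ×
        (∀ (K : Subset) → IsConvexSubgroup K → ¬ (K +mul p) g → K ⊆ H))

  InSp : ℕ → Subset → Set₁
  InSp p β = ∃[ g ] IsHpg p g β

  Between : ℕ → Subset → Subset → Set₁
  Between p α D = Σ Subset λ β → InSp p β × α ⊊ β × β ⊊ D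

  -- the set { β + nG : β ∈ 𝒮_p, D ⊋ β ⊋ α } as a setoid (elements identified
  -- when the cosets-sets β + nG coincide as subsets of G)
  CosetSet : ℕ → ℕ → Subset → Subset → Setoid (lsuc 0ℓ) 0ℓ
  CosetSet p n α D = record
    { Carrier = Between p α D
    ; _≈_ = λ { (β , _) (β' , _) → (β +mul n) ≐ (β' +mul n) }
    ; isEquivalence = record
      { refl = (λ x z → z) , (λ x z → z)
      ; sym = λ { (f , g) → g , f }
      ; trans = λ { (f , g) (f' , g') → (λ x z → f' x (f x z)) , (λ x z → g x (g' x z)) }
      }
    }

  SameCard : ∀ {a b} → Setoid a 0ℓ → Setoid b 0ℓ → Set _
  SameCard S T = Bijection S T

{-# OPTIONS --safe #-}
-- Sending β + pG to β + pˢG is well defined and injective because, for convex subgroups H and K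
-- and m ≥ 1, H + mG ⊆ K + mG iff H + mˢG ⊆ K + mˢG. Backwards this is mˢG ⊆ mG; forwards,
-- H ⊆ K + mG is lifted to H ⊆ K + mᵏG one factor of m at a time, using that convex subgroups are
-- pure (n·y ∈ H with n ≥ 1 forces y ∈ H) and totally ordered by inclusion. Members of the index
-- set are convex subgroups since they properly contain α ∋ 0, hence are not {0}. Primality of p
-- is used only through p ≠ 0, and the hypotheses on D only delimit the index set.
module Submission where

open import Defs
open import Data.Nat using (ℕ; _≤_; _^_)
open import Data.Nat.Primality using (Prime)

open import Algebra.Bundles using (AbelianGroup)
import Algebra.Properties.CommutativeSemigroup as CommutativeSemigroupProperties
import Algebra.Properties.Group as GroupProperties
open import Data.Empty using (⊥-elim)
open import Data.Nat as ℕ using (zero; suc; NonZero)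
open import Data.Nat.Primality using (prime⇒nonZero)
open import Data.Product using (_×_; _,_; proj₁; ∃-syntax)
open import Data.Product.Function.NonDependent.Propositional using (_×-⇔_)
open import Data.Sum using (_⊎_; inj₁; inj₂)
open import Function.Bundles using (_⇔_; mk⇔; module Equivalence)
open import Level using (0ℓ)
open import Relation.Binary.PropositionalEquality
  using (_≡_; refl; sym; trans; cong; cong₂; subst; subst₂; isEquivalence; module ≡-Reasoning)
open import Relation.Nullary using (¬_)

module _ (G : OrderedAbelianGroup) where
  open OrderedAbelianGroup G renaming (_≤_ to _≼_)
  open ≡-Reasoning
  open Equivalence using (to; from)

  private
    variable
      x y b : Carrier
      A B H K : Subset G

  +-identityˡ : ∀ x → 0# + x ≡ x
  +-identityˡ x = trans (+-comm 0# x) (+-idʳ x)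

  +-inverseˡ : ∀ x → - x + x ≡ 0#
  +-inverseˡ x = trans (+-comm (- x) x) (+-invʳ x)

  abelianGroup : AbelianGroup 0ℓ 0ℓ
  abelianGroup = record
    { Carrier = Carrier
    ; _≈_ = _≡_
    ; _∙_ = _+_
    ; ε = 0#
    ; _⁻¹ = -_
    ; isAbelianGroup = record
      { isGroup = record
        { isMonoid = record
          { isSemigroup = record
            { isMagma = record { isEquivalence = isEquivalence ; ∙-cong = cong₂ _+_ }
            ; assoc = +-assoc
            }
          ; identity = +-identityˡ , +-idʳ
          }
        ; inverse = +-inverseˡ , +-invʳ
        ; ⁻¹-cong = cong -_
        }
      ; comm = +-comm
      }
    }

  open GroupProperties (AbelianGroup.group abelianGroup) using (⁻¹-involutive; \\-leftDividesʳ)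
  open CommutativeSemigroupProperties (AbelianGroup.commutativeSemigroup abelianGroup)
    using (interchange)

  infixr 8 _·ᴳ_
  _·ᴳ_ : ℕ → Carrier → Carrier
  _·ᴳ_ = _·_ G

  ·-zeroʳ : ∀ n → n ·ᴳ 0# ≡ 0#
  ·-zeroʳ zero    = refl
  ·-zeroʳ (suc n) = trans (+-identityˡ (n ·ᴳ 0#)) (·-zeroʳ n)

  ·-distribˡ : ∀ n x y → n ·ᴳ (x + y) ≡ n ·ᴳ x + n ·ᴳ y
  ·-distribˡ zero    x y = sym (+-idʳ 0#)
  ·-distribˡ (suc n) x y =
    trans (cong ((x + y) +_) (·-distribˡ n x y)) (interchange x y (n ·ᴳ x) (n ·ᴳ y))

  ·-homo-+ : ∀ m n x → (m ℕ.+ n) ·ᴳ x ≡ m ·ᴳ x + n ·ᴳ x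
  ·-homo-+ zero    n x = sym (+-identityˡ (n ·ᴳ x))
  ·-homo-+ (suc m) n x = trans (cong (x +_) (·-homo-+ m n x)) (sym (+-assoc x (m ·ᴳ x) (n ·ᴳ x)))

  ·-assoc : ∀ m n x → (m ℕ.* n) ·ᴳ x ≡ m ·ᴳ n ·ᴳ x
  ·-assoc zero    n x = refl
  ·-assoc (suc m) n x = trans (·-homo-+ n (m ℕ.* n) x) (cong (n ·ᴳ x +_) (·-assoc m n x))

  +-monoʳ-≼ : ∀ z {x y} → x ≼ y → z + x ≼ z + y
  +-monoʳ-≼ z {x} {y} x≼y = subst₂ _≼_ (+-comm x z) (+-comm y z) (≤-+-compat z x≼y)

  +-mono-≼ : ∀ {a b c d} → a ≼ b → c ≼ d → a + c ≼ b + d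
  +-mono-≼ {b = b} {c} a≼b c≼d = ≤-trans (≤-+-compat c a≼b) (+-monoʳ-≼ b c≼d)

  ·-mono-≼ : ∀ n {x y} → x ≼ y → n ·ᴳ x ≼ n ·ᴳ y
  ·-mono-≼ zero    x≼y = ≤-refl 0#
  ·-mono-≼ (suc n) x≼y = +-mono-≼ x≼y (·-mono-≼ n x≼y)

  y≼suc[n]·y : ∀ n → 0# ≼ y → y ≼ suc n ·ᴳ y
  y≼suc[n]·y {y} n 0≼y =
    subst (_≼ suc n ·ᴳ y) (+-idʳ y) (+-monoʳ-≼ y (subst (_≼ n ·ᴳ y) (·-zeroʳ n) (·-mono-≼ n 0≼y)))

  suc[n]·y≼y : ∀ n → y ≼ 0# → suc n ·ᴳ y ≼ y
  suc[n]·y≼y {y} n y≼0 =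
    subst (suc n ·ᴳ y ≼_) (+-idʳ y) (+-monoʳ-≼ y (subst (n ·ᴳ y ≼_) (·-zeroʳ n) (·-mono-≼ n y≼0)))

  0≼-x : x ≼ 0# → 0# ≼ - x
  0≼-x {x} x≼0 = subst₂ _≼_ (+-invʳ x) (+-identityˡ (- x)) (≤-+-compat (- x) x≼0)

  magnitude : ∀ x → ∃[ u ] (0# ≼ u × (u ≡ x ⊎ u ≡ - x))
  magnitude x with ≤-total 0# x
  ... | inj₁ 0≼x = x , 0≼x , inj₁ refl
  ... | inj₂ x≼0 = - x , 0≼-x x≼0 , inj₂ refl

  subgroup-·-closed : IsSubgroup G H → ∀ n → H x → H (n ·ᴳ x)
  subgroup-·-closed (0∈H , _ , _) zero _ = 0∈H
  subgroup-·-closed {x = x} H-sg@(_ , +-closed , _) (suc n) x∈H =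
    +-closed x (n ·ᴳ x) x∈H (subgroup-·-closed H-sg n x∈H)

  subgroup-±-closed : IsSubgroup G H → y ≡ x ⊎ y ≡ - x → H x → H y
  subgroup-±-closed _                  (inj₁ refl) x∈H = x∈H
  subgroup-±-closed (_ , _ , -‿closed) (inj₂ refl) x∈H = -‿closed _ x∈H

  subgroup-±-closed⁻¹ : IsSubgroup G H → y ≡ x ⊎ y ≡ - x → H y → H x
  subgroup-±-closed⁻¹ _ (inj₁ refl) y∈H = y∈H
  subgroup-±-closed⁻¹ {H = H} (_ , _ , -‿closed) (inj₂ refl) y∈H =
    subst H (⁻¹-involutive _) (-‿closed _ y∈H)

  convexSubgroup-pure : IsConvexSubgroup G H → ∀ n → H (suc n ·ᴳ y) → H y
  convexSubgroup-pure {y = y} ((0∈H , _) , H-convex) n ny∈H with ≤-total 0# y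
  ... | inj₁ 0≼y = H-convex 0# (suc n ·ᴳ y) y 0∈H ny∈H 0≼y (y≼suc[n]·y n 0≼y)
  ... | inj₂ y≼0 = H-convex (suc n ·ᴳ y) 0# y ny∈H 0∈H (suc[n]·y≼y n y≼0) y≼0

  -- Constructive form of "convex subgroups form a chain": comparing the magnitudes of a
  -- witness in each subgroup decides which inclusion is witnessed.
  convexSubgroup-comparable : IsConvexSubgroup G H → IsConvexSubgroup G K → H x → K y → K x ⊎ H y
  convexSubgroup-comparable {x = x} {y} (H-sg , H-convex) (K-sg , K-convex) x∈H y∈K
    with magnitude x | magnitude y
  ... | u , 0≼u , u≡±x | v , 0≼v , v≡±y with ≤-total u v
  ... | inj₁ u≼v = inj₁ (subgroup-±-closed⁻¹ K-sg u≡±x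
                     (K-convex 0# v u (proj₁ K-sg) (subgroup-±-closed K-sg v≡±y y∈K) 0≼u u≼v))
  ... | inj₂ v≼u = inj₂ (subgroup-±-closed⁻¹ H-sg v≡±y
                     (H-convex 0# u v (proj₁ H-sg) (subgroup-±-closed H-sg u≡±x x∈H) 0≼v v≼u))

  ⊆+mul : ∀ n → _⊆_ G H (_+mul_ G H n)
  ⊆+mul n b b∈H = b , 0# , b∈H , sym (trans (cong (b +_) (·-zeroʳ n)) (+-idʳ b))

  +mul-⊆⇔⊆+mul : ∀ n → _⊆_ G (_+mul_ G A n) (_+mul_ G B n) ⇔ _⊆_ G A (_+mul_ G B n)
  +mul-⊆⇔⊆+mul {A} {B} n = mk⇔ (λ A+nG⊆ a a∈A → A+nG⊆ a (⊆+mul n a a∈A)) absorb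
    where
    absorb : _⊆_ G A (_+mul_ G B n) → _⊆_ G (_+mul_ G A n) (_+mul_ G B n)
    absorb A⊆B+nG x (a , y , a∈A , x≡a+ny) with A⊆B+nG a a∈A
    ... | b , z , b∈B , a≡b+nz = b , z + y , b∈B , (begin
      x                         ≡⟨ x≡a+ny ⟩
      a + n ·ᴳ y                ≡⟨ cong (_+ n ·ᴳ y) a≡b+nz ⟩
      (b + n ·ᴳ z) + n ·ᴳ y     ≡⟨ +-assoc b (n ·ᴳ z) (n ·ᴳ y) ⟩
      b + (n ·ᴳ z + n ·ᴳ y)     ≡⟨ cong (b +_) (·-distribˡ n z y) ⟨
      b + n ·ᴳ (z + y)          ∎)

  +mul-*-⊆ : ∀ m k → _⊆_ G (_+mul_ G H (m ℕ.* k)) (_+mul_ G H m)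
  +mul-*-⊆ m k x (b , y , b∈H , x≡b+mky) =
    b , k ·ᴳ y , b∈H , trans x≡b+mky (cong (b +_) (·-assoc m k y))

  +mul-*-step : IsSubgroup G H → ∀ m n → H b → _+mul_ G H n y →
                _+mul_ G H (m ℕ.* n) (b + m ·ᴳ y)
  +mul-*-step {b = b} H-sg@(_ , +-closed , _) m n b∈H (b′ , z , b′∈H , refl) =
    b + m ·ᴳ b′ , z , +-closed b (m ·ᴳ b′) b∈H (subgroup-·-closed H-sg m b′∈H) , (begin
      b + m ·ᴳ (b′ + n ·ᴳ z)            ≡⟨ cong (b +_) (·-distribˡ m b′ (n ·ᴳ z)) ⟩
      b + (m ·ᴳ b′ + m ·ᴳ n ·ᴳ z)       ≡⟨ +-assoc b (m ·ᴳ b′) (m ·ᴳ n ·ᴳ z) ⟨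
      (b + m ·ᴳ b′) + m ·ᴳ n ·ᴳ z       ≡⟨ cong (b + m ·ᴳ b′ +_) (·-assoc m n z) ⟨
      (b + m ·ᴳ b′) + (m ℕ.* n) ·ᴳ z    ∎)

  -- In x = b + m·y with b ∈ K, either x ∈ K already, or comparability puts b in H; then
  -- m·y ∈ H, so y ∈ H by purity, and induction rewrites y modulo K + mᵏG.
  ⊆+mul-^ : IsConvexSubgroup G H → IsConvexSubgroup G K → ∀ q →
            _⊆_ G H (_+mul_ G K (suc q)) → ∀ k → _⊆_ G H (_+mul_ G K (suc q ^ k))
  ⊆+mul-^ _ ((0∈K , _) , _) _ _ zero x _ = 0# , x , 0∈K , sym (trans (+-identityˡ _) (+-idʳ x))
  ⊆+mul-^ {H} {K} H-cs@((_ , +-closed , -‿closed) , _) K-cs q H⊆K+mG (suc k) x x∈H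
    with H⊆K+mG x x∈H
  ... | b , y , b∈K , x≡b+my with convexSubgroup-comparable H-cs K-cs x∈H b∈K
  ... | inj₁ x∈K = ⊆+mul (suc q ^ suc k) x x∈K
  ... | inj₂ b∈H =
    subst (_+mul_ G K (suc q ^ suc k)) (sym x≡b+my)
      (+mul-*-step (proj₁ K-cs) (suc q) (suc q ^ k) b∈K (⊆+mul-^ H-cs K-cs q H⊆K+mG k y y∈H))
    where
    -b+x≡my : - b + x ≡ suc q ·ᴳ y
    -b+x≡my = trans (cong (- b +_) x≡b+my) (\\-leftDividesʳ b (suc q ·ᴳ y))

    y∈H : H y
    y∈H = convexSubgroup-pure H-cs q (subst H -b+x≡my (+-closed (- b) x (-‿closed b b∈H) x∈H))

  +mul-^-⊆⇔ : IsConvexSubgroup G H → IsConvexSubgroup G K → ∀ q t →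
              _⊆_ G (_+mul_ G H (suc q)) (_+mul_ G K (suc q)) ⇔
              _⊆_ G (_+mul_ G H (suc q ^ suc t)) (_+mul_ G K (suc q ^ suc t))
  +mul-^-⊆⇔ H-cs K-cs q t = mk⇔
    (λ H+mG⊆K+mG → from (+mul-⊆⇔⊆+mul mˢ)
      (⊆+mul-^ H-cs K-cs q (to (+mul-⊆⇔⊆+mul m) H+mG⊆K+mG) (suc t)))
    (λ H+mˢG⊆K+mˢG → from (+mul-⊆⇔⊆+mul m) λ x x∈H →
      +mul-*-⊆ m (suc q ^ t) x (to (+mul-⊆⇔⊆+mul mˢ) H+mˢG⊆K+mˢG x x∈H))
    where
    m mˢ : ℕ
    m  = suc q
    mˢ = suc q ^ suc t

  +mul-^-≐⇔ : IsConvexSubgroup G H → IsConvexSubgroup G K → ∀ q t →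
              _≐_ G (_+mul_ G H (suc q)) (_+mul_ G K (suc q)) ⇔
              _≐_ G (_+mul_ G H (suc q ^ suc t)) (_+mul_ G K (suc q ^ suc t))
  +mul-^-≐⇔ H-cs K-cs q t = +mul-^-⊆⇔ H-cs K-cs q t ×-⇔ +mul-^-⊆⇔ K-cs H-cs q t

  InSp-isConvexSubgroup : ∀ {p} → InSp G p H → ¬ _⊆_ G H (zeroSubgroup G) → IsConvexSubgroup G H
  InSp-isConvexSubgroup (_ , trivial-if-g∈pG , maximal-if-g∉pG) H⊈0 =
    proj₁ (maximal-if-g∉pG λ g∈pG → H⊈0 (proj₁ (trivial-if-g∈pG g∈pG)))

  Between-isConvexSubgroup : ∀ {p α D} → IsSubgroup G α → (β : Between G p α D) →
                             IsConvexSubgroup G (proj₁ β)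
  Between-isConvexSubgroup {p} {α} (0∈α , _) (_ , β∈Sp , (_ , β⊈α) , _) =
    InSp-isConvexSubgroup {p = p} β∈Sp λ β⊆0 → β⊈α λ x x∈β → subst α (sym (β⊆0 x x∈β)) 0∈α

  CosetSet-sameCard : ∀ p m n {α D} →
    (∀ (β β′ : Between G p α D) →
       _≐_ G (_+mul_ G (proj₁ β) m) (_+mul_ G (proj₁ β′) m) ⇔
       _≐_ G (_+mul_ G (proj₁ β) n) (_+mul_ G (proj₁ β′) n)) →
    SameCard G (CosetSet G p m α D) (CosetSet G p n α D)
  CosetSet-sameCard _ _ _ same-cosets = record
    { to        = λ β → β
    ; cong      = λ {β} {β′} → to (same-cosets β β′)
    ; bijective = (λ {β} {β′} → from (same-cosets β β′))
                , λ β → β , λ {β′} → to (same-cosets β′ β)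
    }

mainTheorem12 : (G : OrderedAbelianGroup) (p s : ℕ) → Prime p → 1 ≤ s →
    (α D : Subset G) → IsConvexSubgroup G α → IsConvexSubgroup G D → _⊊_ G α D →
    SameCard G (CosetSet G p p α D) (CosetSet G p (p ^ s) α D)
mainTheorem12 G zero    _       p-prime _ _ _ _ _ _ =
  ⊥-elim (NonZero.nonZero (prime⇒nonZero p-prime))
mainTheorem12 G (suc q) (suc t) _       _ α D (α-subgroup , _) _ _ =
  CosetSet-sameCard G (suc q) (suc q) (suc q ^ suc t) λ β β′ →
    +mul-^-≐⇔ G (β-convex β) (β-convex β′) q t
  where
  β-convex : (β : Between G (suc q) α D) → IsConvexSubgroup G (proj₁ β)
  β-convex = Between-isConvexSubgroup G {suc q} α-subgroup
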